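{- Let $A$ be an $m \times n$ $0,1$-matrix with $m,n \ge 2$ which is $t$-mixed free. Then its corner matrix $B$ is $2t$-grid free.
   Context: A submatrix here means a matrix formed by consecutive rows and consecutive columns. A matrix is vertical if all its rows are equal, horizontal if all its columns are equal, and mixed if it is neither. A corner is a $2\times 2$ mixed matrix. The corner matrix $B$ of an $m\times n$ $0,1$-matrix $A$ ($m,n\ge 2$) is the $(m-1)\times(n-1)$ matrix with $B[i][j]=1$ if the submatrix of $A$ on rows $i,i+1$ and columns $j,j+1$ is a corner, and $B[i][j]=0$ otherwise. A $(k,l)$-division of a matrix is a partition of its rows into $k$ non-empty parts each consisting of consecutive rows, together with a partition of its columns into $l$ non-empty parts each consisting of consecutive columns; its zones are the submatrices formed by one row part and one column part. A $t$-grid minor is a $(t,t)$-division in which every zone contains an entry $1$; a $t$-mixed minor is a $(t,t)$-division in which every zone is mixed. A matrix is $t$-grid free (resp. $t$-mixed free) if it has no $t$-grid minor (resp. $t$-mixed minor). -}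

module Defs where

open import Data.Nat using (ℕ; zero; suc; _+_; _∸_; _≤_; _<_)
open import Data.Fin using (Fin; toℕ; fromℕ; inject₁) renaming (suc to fsuc; zero to fzero)
open import Data.Bool using (Bool; true; false)
open import Data.Product using (Σ; _×_; ∃-syntax; _,_)
open import Relation.Binary.PropositionalEquality using (_≡_; _≢_)
open import Relation.Nullary using (¬_)

Matrix : ℕ → ℕ → Set
Matrix m n = Fin m → Fin n → Bool

Vertical : ∀ {m n} → Matrix m n → (r₀ r₁ c₀ c₁ : ℕ) → Set
Vertical {m} {n} A r₀ r₁ c₀ c₁ =
  ∀ (r r' : Fin m) (c : Fin n) →
    r₀ ≤ toℕ r → toℕ r < r₁ → r₀ ≤ toℕ r' → toℕ r' < r₁ →
    c₀ ≤ toℕ c → toℕ c < c₁ → A r c ≡ A r' c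

Horizontal : ∀ {m n} → Matrix m n → (r₀ r₁ c₀ c₁ : ℕ) → Set
Horizontal {m} {n} A r₀ r₁ c₀ c₁ =
  ∀ (r : Fin m) (c c' : Fin n) →
    r₀ ≤ toℕ r → toℕ r < r₁ → c₀ ≤ toℕ c → toℕ c < c₁ →
    c₀ ≤ toℕ c' → toℕ c' < c₁ → A r c ≡ A r c'

Mixed : ∀ {m n} → Matrix m n → (r₀ r₁ c₀ c₁ : ℕ) → Set
Mixed A r₀ r₁ c₀ c₁ = ¬ Vertical A r₀ r₁ c₀ c₁ × ¬ Horizontal A r₀ r₁ c₀ c₁

-- Corner matrix of an (suc m) × (suc n) matrix (i.e. sizes m+1, n+1 ≥ 2 when m,n ≥ 1):
-- B[i][j] = 1 iff the 2×2 submatrix on rows i,i+1 and columns j,j+1 is mixed.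
open import Relation.Nullary using (Dec; yes; no)
open import Data.Bool using (_≟_)

mixed2 : Bool → Bool → Bool → Bool → Bool
-- a b / c d ; vertical iff a≡c and b≡d ; horizontal iff a≡b and c≡d
mixed2 a b c d with a ≟ c | b ≟ d | a ≟ b | c ≟ d
... | yes _ | yes _ | _     | _     = false
... | _     | _     | yes _ | yes _ = false
... | _     | _     | _     | _     = true

cornerMatrix : ∀ {m n} → Matrix (suc m) (suc n) → Matrix m n
cornerMatrix A i j =
  mixed2 (A (inject₁ i) (inject₁ j)) (A (inject₁ i) (fsuc j))
         (A (fsuc i) (inject₁ j)) (A (fsuc i) (fsuc j))

record Division (k m : ℕ) : Set where
  field
    bound : Fin (suc k) → ℕ
    start : bound fzero ≡ 0
    end   : bound (fromℕ k) ≡ m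
    incr  : ∀ (p : Fin k) → bound (inject₁ p) < bound (fsuc p)
open Division public

MixedMinor : ∀ {m n} → ℕ → Matrix m n → Set
MixedMinor {m} {n} t A =
  Σ (Division t m) λ R → Σ (Division t n) λ C →
    ∀ (p q : Fin t) →
      Mixed A (bound R (inject₁ p)) (bound R (fsuc p)) (bound C (inject₁ q)) (bound C (fsuc q))

MixedFree : ∀ {m n} → ℕ → Matrix m n → Set
MixedFree t A = ¬ MixedMinor t A

GridMinor : ∀ {m n} → ℕ → Matrix m n → Set
GridMinor {m} {n} t A =
  Σ (Division t m) λ R → Σ (Division t n) λ C →
    ∀ (p q : Fin t) → ∃[ r ] ∃[ c ]
      (bound R (inject₁ p) ≤ toℕ r × toℕ r < bound R (fsuc p) ×
       bound C (inject₁ q) ≤ toℕ c × toℕ c < bound C (fsuc q) × A r c ≡ true)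

GridFree : ∀ {m n} → ℕ → Matrix m n → Set
GridFree t A = ¬ GridMinor t A

{-# OPTIONS --safe #-}
module Submission where

open import Defs
open import Data.Nat using (ℕ; suc; _+_; _*_; _≤_; _<_; z≤n; s≤s; _≤?_)
open import Data.Nat.Properties
open import Data.Fin using (Fin; toℕ; fromℕ; fromℕ<; inject₁) renaming (suc to fsuc; zero to fzero)
open import Data.Fin.Properties using (toℕ-fromℕ; toℕ-fromℕ<; toℕ-inject₁; fromℕ<-toℕ; toℕ<n)
open import Data.Bool using (true; false)
open import Data.Product using (_×_; _,_)
open import Data.Empty using (⊥-elim)
open import Relation.Binary.PropositionalEquality
open import Relation.Nullary using (¬_; yes; no)

-- Merge the parts of a 2t-grid minor of the corner matrix B pairwise:
-- part p of the new division starts where part 2p of the old one does and runs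
-- through part 2p+1, the last one being stretched by one row (column) since A
-- is one row (column) larger than B. An entry 1 of B in zone (2p,2q) is a 2×2
-- corner of A that then lies entirely inside zone (p,q) of the new division, so
-- every zone of this (t,t)-division of A is mixed.

mixed2-vertical : ∀ a b → mixed2 a b a b ≡ false
mixed2-vertical false false = refl
mixed2-vertical false true  = refl
mixed2-vertical true  false = refl
mixed2-vertical true  true  = refl

mixed2-horizontal : ∀ a c → mixed2 a a c c ≡ false
mixed2-horizontal false false = refl
mixed2-horizontal false true  = refl
mixed2-horizontal true  false = refl
mixed2-horizontal true  true  = refl

corner⇒mixed : ∀ {m n} (A : Matrix (suc m) (suc n)) {i : Fin m} {j : Fin n} {r₀ r₁ c₀ c₁ : ℕ} →
  cornerMatrix A i j ≡ true →
  r₀ ≤ toℕ i × suc (toℕ i) < r₁ → c₀ ≤ toℕ j × suc (toℕ j) < c₁ →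
  Mixed A r₀ r₁ c₀ c₁
corner⇒mixed A {i} {j} corner (r₀≤i , i+1<r₁) (c₀≤j , j+1<c₁) = notVertical , notHorizontal
  where
  r₀≤i′ : _ ≤ toℕ (inject₁ i)
  r₀≤i′ = ≤-trans r₀≤i (≤-reflexive (sym (toℕ-inject₁ i)))
  i′<r₁ : toℕ (inject₁ i) < _
  i′<r₁ = ≤-<-trans (≤-reflexive (toℕ-inject₁ i)) (<-trans (n<1+n _) i+1<r₁)
  r₀≤i+1 : _ ≤ suc (toℕ i)
  r₀≤i+1 = m≤n⇒m≤1+n r₀≤i
  c₀≤j′ : _ ≤ toℕ (inject₁ j)
  c₀≤j′ = ≤-trans c₀≤j (≤-reflexive (sym (toℕ-inject₁ j)))
  j′<c₁ : toℕ (inject₁ j) < _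
  j′<c₁ = ≤-<-trans (≤-reflexive (toℕ-inject₁ j)) (<-trans (n<1+n _) j+1<c₁)
  c₀≤j+1 : _ ≤ suc (toℕ j)
  c₀≤j+1 = m≤n⇒m≤1+n c₀≤j

  a = A (inject₁ i) (inject₁ j)
  b = A (inject₁ i) (fsuc j)
  c = A (fsuc i) (inject₁ j)
  d = A (fsuc i) (fsuc j)

  notVertical : ¬ Vertical A _ _ _ _
  notVertical V with trans (sym (mixed2-vertical a b)) (trans (cong₂ (mixed2 a b) a≡c b≡d) corner)
    where
    a≡c = V (inject₁ i) (fsuc i) (inject₁ j) r₀≤i′ i′<r₁ r₀≤i+1 i+1<r₁ c₀≤j′ j′<c₁
    b≡d = V (inject₁ i) (fsuc i) (fsuc j) r₀≤i′ i′<r₁ r₀≤i+1 i+1<r₁ c₀≤j+1 j+1<c₁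
  ... | ()

  notHorizontal : ¬ Horizontal A _ _ _ _
  notHorizontal H with trans (sym (mixed2-horizontal a c)) (trans (cong₂ (λ x y → mixed2 a x c y) a≡b c≡d) corner)
    where
    a≡b = H (inject₁ i) (inject₁ j) (fsuc j) r₀≤i′ i′<r₁ c₀≤j′ j′<c₁ c₀≤j+1 j+1<c₁
    c≡d = H (fsuc i) (inject₁ j) (fsuc j) r₀≤i+1 i+1<r₁ c₀≤j′ j′<c₁ c₀≤j+1 j+1<c₁
  ... | ()

fromBoundaries : ∀ {k m} (b : ℕ → ℕ) → b 0 ≡ 0 → b k ≡ m → (∀ {p} → p < k → b p < b (suc p)) →
  Division k m
fromBoundaries {k} b b₀ bₖ b-incr = record
  { bound = λ x → b (toℕ x)
  ; start = b₀
  ; end   = trans (cong b (toℕ-fromℕ k)) bₖ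
  ; incr  = λ p → subst (λ x → b x < b (suc (toℕ p))) (sym (toℕ-inject₁ p)) (b-incr (toℕ<n p))
  }

module Boundaries {k m : ℕ} (R : Division k m) where

  -- Only the arguments i ≤ k matter; beyond them the value m is junk.
  boundAt : ℕ → ℕ
  boundAt i with i ≤? k
  ... | yes i≤k = bound R (fromℕ< (s≤s i≤k))
  ... | no  _   = m

  boundAt-toℕ : (x : Fin (suc k)) → boundAt (toℕ x) ≡ bound R x
  boundAt-toℕ x with toℕ x ≤? k
  ... | yes x≤k = cong (bound R) (fromℕ<-toℕ x (s≤s x≤k))
  ... | no  x≰k = ⊥-elim (x≰k (≤-pred (toℕ<n x)))

  boundAt-inject₁ : (p : Fin k) → bound R (inject₁ p) ≡ boundAt (toℕ p)
  boundAt-inject₁ p = trans (sym (boundAt-toℕ (inject₁ p))) (cong boundAt (toℕ-inject₁ p))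

  boundAt-fsuc : (p : Fin k) → bound R (fsuc p) ≡ boundAt (suc (toℕ p))
  boundAt-fsuc p = sym (boundAt-toℕ (fsuc p))

  boundAt-zero : boundAt 0 ≡ 0
  boundAt-zero = trans (boundAt-toℕ fzero) (start R)

  boundAt-end : boundAt k ≡ m
  boundAt-end = trans (cong boundAt (sym (toℕ-fromℕ k))) (trans (boundAt-toℕ (fromℕ k)) (end R))

  boundAt-incr : ∀ {p} → p < k → boundAt p < boundAt (suc p)
  boundAt-incr {p} p<k = subst₂ _<_ lower upper (incr R x)
    where
    x : Fin k
    x = fromℕ< p<k
    lower : bound R (inject₁ x) ≡ boundAt p
    lower = trans (boundAt-inject₁ x) (cong boundAt (toℕ-fromℕ< p<k))
    upper : bound R (fsuc x) ≡ boundAt (suc p)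
    upper = trans (boundAt-fsuc x) (cong (λ y → boundAt (suc y)) (toℕ-fromℕ< p<k))

double : ∀ {t} → Fin t → Fin (2 * t)
double p = fromℕ< (*-monoʳ-< 2 (toℕ<n p))

toℕ-double : ∀ {t} (p : Fin t) → toℕ (double p) ≡ 2 * toℕ p
toℕ-double p = toℕ-fromℕ< (*-monoʳ-< 2 (toℕ<n p))

module Halving {t m : ℕ} (R : Division (2 * suc t) m) where
  open Boundaries R

  2p+1<2t : ∀ {p} → p ≤ t → suc (2 * p) < 2 * suc t
  2p+1<2t {p} p≤t = subst (_≤ 2 * suc t) (*-suc 2 p) (*-monoʳ-≤ 2 (s≤s p≤t))

  halfBoundAt : ℕ → ℕ
  halfBoundAt p with p ≤? t
  ... | yes _ = boundAt (2 * p)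
  ... | no  _ = suc m

  halfBoundAt-≤ : ∀ {p} → p ≤ t → halfBoundAt p ≡ boundAt (2 * p)
  halfBoundAt-≤ {p} p≤t with p ≤? t
  ... | yes _   = refl
  ... | no  p≰t = ⊥-elim (p≰t p≤t)

  halfBoundAt-end : halfBoundAt (suc t) ≡ suc m
  halfBoundAt-end with suc t ≤? t
  ... | yes t+1≤t = ⊥-elim (<-irrefl refl t+1≤t)
  ... | no  _     = refl

  boundAt-odd<halfBoundAt : ∀ {p} → p ≤ t → boundAt (suc (2 * p)) < halfBoundAt (suc p)
  boundAt-odd<halfBoundAt {p} p≤t = begin-strict
    boundAt (suc (2 * p))  <⟨ boundAt-incr (2p+1<2t p≤t) ⟩
    boundAt (2 + 2 * p)    ≡⟨ cong boundAt (*-suc 2 p) ⟨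
    boundAt (2 * suc p)    ≤⟨ next≤ ⟩
    halfBoundAt (suc p)    ∎
    where
    open ≤-Reasoning
    next≤ : boundAt (2 * suc p) ≤ halfBoundAt (suc p)
    next≤ with suc p ≤? t
    ... | yes _ = ≤-refl
    ... | no  p+1≰t = subst (λ q → boundAt (2 * suc q) ≤ suc m) (≤-antisym (≮⇒≥ p+1≰t) p≤t)
                        (≤-trans (≤-reflexive boundAt-end) (n≤1+n m))

  halfBoundAt-incr : ∀ {p} → p < suc t → halfBoundAt p < halfBoundAt (suc p)
  halfBoundAt-incr {p} (s≤s p≤t) = begin-strict
    halfBoundAt p          ≡⟨ halfBoundAt-≤ p≤t ⟩
    boundAt (2 * p)        <⟨ boundAt-incr (<-trans (n<1+n _) (2p+1<2t p≤t)) ⟩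
    boundAt (suc (2 * p))  <⟨ boundAt-odd<halfBoundAt p≤t ⟩
    halfBoundAt (suc p)    ∎
    where open ≤-Reasoning

  halve : Division (suc t) (suc m)
  halve = fromBoundaries halfBoundAt (trans (halfBoundAt-≤ z≤n) boundAt-zero) halfBoundAt-end halfBoundAt-incr

  halve-covers : (P : Fin (suc t)) {i : ℕ} →
    bound R (inject₁ (double P)) ≤ i → i < bound R (fsuc (double P)) →
    bound halve (inject₁ P) ≤ i × suc i < bound halve (fsuc P)
  halve-covers P {i} lo≤i i<hi = lower , upper
    where
    p≤t : toℕ P ≤ t
    p≤t = ≤-pred (toℕ<n P)
    lower : halfBoundAt (toℕ (inject₁ P)) ≤ i
    lower = begin
      halfBoundAt (toℕ (inject₁ P))  ≡⟨ cong halfBoundAt (toℕ-inject₁ P) ⟩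
      halfBoundAt (toℕ P)            ≡⟨ halfBoundAt-≤ p≤t ⟩
      boundAt (2 * toℕ P)            ≡⟨ cong boundAt (toℕ-double P) ⟨
      boundAt (toℕ (double P))       ≡⟨ boundAt-inject₁ (double P) ⟨
      bound R (inject₁ (double P))   ≤⟨ lo≤i ⟩
      i                              ∎
      where open ≤-Reasoning
    upper : suc i < halfBoundAt (suc (toℕ P))
    upper = begin-strict
      suc i                          ≤⟨ i<hi ⟩
      bound R (fsuc (double P))      ≡⟨ boundAt-fsuc (double P) ⟩
      boundAt (suc (toℕ (double P))) ≡⟨ cong (λ x → boundAt (suc x)) (toℕ-double P) ⟩
      boundAt (suc (2 * toℕ P))      <⟨ boundAt-odd<halfBoundAt p≤t ⟩
      halfBoundAt (suc (toℕ P))      ∎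
      where open ≤-Reasoning

open Halving using (halve; halve-covers)

lemma2 : ∀ (m n t : ℕ) → 1 ≤ m → 1 ≤ n → (A : Matrix (suc m) (suc n)) →
    MixedFree t A → GridFree (2 * t) (cornerMatrix A)
-- A (0,0)-division only exists for the empty matrix, which 1 ≤ m excludes.
lemma2 m n 0 (s≤s _) _ A _ (R , _) = 0≢1+n (trans (sym (start R)) (end R))
lemma2 m n (suc t) _ _ A mixedFree (R , C , gridZones) =
  mixedFree (halve R , halve C , zoneMixed)
  where
  zoneMixed : ∀ P Q → Mixed A (bound (halve R) (inject₁ P)) (bound (halve R) (fsuc P))
                              (bound (halve C) (inject₁ Q)) (bound (halve C) (fsuc Q))
  zoneMixed P Q with gridZones (double P) (double Q)
  ... | i , j , i₀≤i , i<i₁ , j₀≤j , j<j₁ , corner =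
    corner⇒mixed A corner (halve-covers R P i₀≤i i<i₁) (halve-covers C Q j₀≤j j<j₁)
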